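{- For each CNF-formula $\phi$, there exists an $X\in\mathcal{IS}^0_{br}$ in which no jump instruction other than $\#2$ occurs such that $X$ computes the Boolean function induced by $\phi$ and $|X|$ is linear in the size of $\phi$ (bounded by a linear function of the size of $\phi$ with constants independent of $\phi$).
   Context: Let $\mathbb B=\{\mathsf T,\mathsf F\}$. There are Boolean registers named $\mathtt{in}{:}i$ ($i\ge1$), $\mathtt{aux}{:}i$ ($i\ge1$) and $\mathtt{out}$, processing methods $\mathtt{set{:}T}$ (content becomes $\mathsf T$, reply $\mathsf T$), $\mathtt{set{:}F}$ (content becomes $\mathsf F$, reply $\mathsf F$), $\mathtt{get}$ (no change, reply is the content). Basic instructions are $f.m$ ($f$ register name, $m$ method). Primitive instructions: for each basic instruction $a$, the plain instruction $a$, positive test $+a$, negative test $-a$; forward jumps $\#l$ ($l\in\mathbb N$); termination $!$. An instruction sequence is a finite non-empty sequence $X=u_1;\dots;u_k$ of primitive instructions, $|X|=k$. Execution starts at $u_1$: $a$ executes $a$ and proceeds with the next instruction; $+a$ executes $a$ and proceeds with the next instruction if the reply is $\mathsf T$, otherwise skips the next instruction and proceeds with the one after; $-a$ likewise with reply roles reversed; $\#l$ proceeds with the $l$-th next instruction ($\#0$ causes inaction); $!$ terminates; if there is no instruction to proceed with, inaction occurs. $\mathcal{IS}_{br}$ is the set of instruction sequences whose basic instructions are all of the forms $\mathtt{in}{:}i.\mathtt{get}$, $\mathtt{aux}{:}i.\mathtt{get}$, $\mathtt{aux}{:}i.\mathtt{set{:}}b$, $\mathtt{out}.\mathtt{set{:}}b$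 ($b\in\mathbb B$); $\mathcal{IS}^0_{br}$ is the set of $X\in\mathcal{IS}_{br}$ in which no instruction on an auxiliary register occurs. $X$ computes $f:\mathbb B^n\to\mathbb B$ if for all $b_1,\dots,b_n$, executing $X$ with $\mathtt{in}{:}i$ initially $b_i$ ($i\le n$) and all auxiliary registers and $\mathtt{out}$ initially $\mathsf F$, execution never executes an instruction on $\mathtt{in}{:}i$ with $i>n$, ends by executing $!$, and leaves $f(b_1,\dots,b_n)$ in $\mathtt{out}$. For a Boolean formula $\phi$ containing the variables $v_1,\dots,v_n$, the Boolean function induced by $\phi$ is $f:\mathbb B^n\to\mathbb B$ with $f(b_1,\dots,b_n)=\mathsf T$ iff $\phi$ is satisfied by the assignment $v_i\mapsto b_i$. -}

module Defs where

open import Data.Bool using (Bool; true; false; if_then_else_; _∧_; _∨_; not)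
open import Data.Nat using (ℕ; zero; suc; _+_; _≤_; _≤?_; _≟_)
open import Data.Fin using (Fin)
open import Data.List using (List; []; _∷_; drop; length; foldr; map)
open import Data.Nat.ListAction using (sum)
open import Data.Unit using (⊤)
open import Data.List.Relation.Unary.All using (All)
open import Data.Vec using (Vec; lookup) renaming ([] to []ᵥ; _∷_ to _∷ᵥ_)
open import Data.Product using (_×_; _,_; Σ)
open import Data.Sum using (_⊎_)
open import Relation.Binary.PropositionalEquality using (_≡_)
open import Relation.Nullary using (yes; no)

-- in i  is the register in:i, aux i is aux:i (only i ≥ 1 are meaningful)
data Reg : Set where
  inR  : ℕ → Reg
  auxR : ℕ → Reg
  outR : Reg

data Method : Set where
  setT setF get : Method

record Basic : Set where
  constructor _·_
  field
    reg    : Reg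
    method : Method

data Instr : Set where
  plain : Basic → Instr
  ptest : Basic → Instr
  ntest : Basic → Instr
  jump  : ℕ → Instr
  halt  : Instr

InstrSeq : Set
InstrSeq = List Instr

data BrBasic : Basic → Set where
  in-get  : ∀ i → 1 ≤ i → BrBasic (inR i · get)
  aux-get : ∀ i → 1 ≤ i → BrBasic (auxR i · get)
  aux-setT : ∀ i → 1 ≤ i → BrBasic (auxR i · setT)
  aux-setF : ∀ i → 1 ≤ i → BrBasic (auxR i · setF)
  out-setT : BrBasic (outR · setT)
  out-setF : BrBasic (outR · setF)

data Br0Basic : Basic → Set where
  in-get  : ∀ i → 1 ≤ i → Br0Basic (inR i · get)
  out-setT : Br0Basic (outR · setT)
  out-setF : Br0Basic (outR · setF)

data InstrOK (P : Basic → Set) : Instr → Set where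
  plain : ∀ {a} → P a → InstrOK P (plain a)
  ptest : ∀ {a} → P a → InstrOK P (ptest a)
  ntest : ∀ {a} → P a → InstrOK P (ntest a)
  jump  : ∀ l → InstrOK P (jump l)
  halt  : InstrOK P halt

IS-br : InstrSeq → Set
IS-br X = (1 ≤ length X) × All (InstrOK BrBasic) X

IS0-br : InstrSeq → Set
IS0-br X = (1 ≤ length X) × All (InstrOK Br0Basic) X

NotOtherJump : Instr → Set
NotOtherJump (jump l) = l ≡ 2
NotOtherJump _ = ⊤

OnlyJump2 : InstrSeq → Set
OnlyJump2 X = All NotOtherJump X

State : Set
State = Reg → Bool

_≟R_ : Reg → Reg → Bool
inR i ≟R inR j with i ≟ j
... | yes _ = true
... | no _ = false
auxR i ≟R auxR j with i ≟ j
... | yes _ = true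
... | no _ = false
outR ≟R outR = true
_ ≟R _ = false

update : State → Reg → Bool → State
update s f b g = if f ≟R g then b else s g

-- value of in:i given the input vector (b_1,…,b_n); in:0 and in:i, i>n, are F
inputVal : ∀ {n} → Vec Bool n → ℕ → Bool
inputVal []ᵥ _ = false
inputVal (b ∷ᵥ _) zero = false
inputVal (b ∷ᵥ _) (suc zero) = b
inputVal (_ ∷ᵥ bs) (suc (suc i)) = inputVal bs (suc i)

initState : ∀ {n} → Vec Bool n → State
initState bs (inR i) = inputVal bs i
initState bs (auxR _) = false
initState bs outR = false

data BasicResult : Set where
  forbidden : BasicResult
  reply     : Bool → State → BasicResult

doMethod : State → Reg → Method → BasicResult
doMethod s f setT = reply true (update s f true)
doMethod s f setF = reply false (update s f false)
doMethod s f get  = reply (s f) s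

doBasic : ℕ → Basic → State → BasicResult
doBasic n (inR i · m) s with 1 ≤? i | i ≤? n
... | yes _ | yes _ = doMethod s (inR i) m
... | _     | _     = forbidden
doBasic n (f · m) s = doMethod s f m

data Outcome : Set where
  terminated : Bool → Outcome
  inaction   : Outcome
  forbidden  : Outcome

-- Execution with fuel. Since every step moves strictly forward in the
-- sequence, fuel ≥ length of the remaining sequence is never exhausted.
exec : ℕ → ℕ → InstrSeq → State → Outcome
exec n zero _ _ = inaction
exec n (suc k) [] s = inaction
exec n (suc k) (halt ∷ _) s = terminated (s outR)
exec n (suc k) (jump zero ∷ _) s = inaction
exec n (suc k) (jump (suc l) ∷ rest) s = exec n k (drop l rest) s
exec n (suc k) (plain a ∷ rest) s with doBasic n a s
... | forbidden = forbidden
... | reply _ s' = exec n k rest s'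
exec n (suc k) (ptest a ∷ rest) s with doBasic n a s
... | forbidden = forbidden
... | reply true s' = exec n k rest s'
... | reply false s' = exec n k (drop 1 rest) s'
exec n (suc k) (ntest a ∷ rest) s with doBasic n a s
... | forbidden = forbidden
... | reply false s' = exec n k rest s'
... | reply true s' = exec n k (drop 1 rest) s'

run : ∀ {n} → InstrSeq → Vec Bool n → Outcome
run {n} X bs = exec n (length X) X (initState bs)

Computes : ∀ n → InstrSeq → (Vec Bool n → Bool) → Set
Computes n X f = ∀ (bs : Vec Bool n) → run X bs ≡ terminated (f bs)

-- CNF formulas over the variables v_1,…,v_n (variable v_{i+1} is  i : Fin n)

record Literal (n : ℕ) : Set where
  constructor lit
  field
    var      : Fin n
    positive : Bool

Clause : ℕ → Set
Clause n = List (Literal n)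

CNF : ℕ → Set
CNF n = List (Clause n)

evalLit : ∀ {n} → Vec Bool n → Literal n → Bool
evalLit bs (lit v true)  = lookup bs v
evalLit bs (lit v false) = not (lookup bs v)

evalClause : ∀ {n} → Vec Bool n → Clause n → Bool
evalClause bs c = foldr (λ l r → evalLit bs l ∨ r) false c

induced : ∀ {n} → CNF n → Vec Bool n → Bool
induced φ bs = foldr (λ c r → evalClause bs c ∧ r) true φ

size : ∀ {n} → CNF n → ℕ
size φ = sum (map (λ c → suc (length c)) φ)

module Submission where

open import Defs
open import Data.Nat using (ℕ; _+_; _*_; _≤_)
open import Data.List using (length)
open import Data.Product using (Σ; _×_)

open import Data.Bool using (Bool; true; false; if_then_else_; _∧_)
open import Data.Nat using (suc; z≤n; s≤s; _≤?_)
open import Data.Nat.Properties using (≤-refl; ≤-trans; n≤1+n; +-monoʳ-≤; +-mono-≤; +-assoc; *-suc; *-distribˡ-+; module ≤-Reasoning)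
open import Data.Fin using (Fin; toℕ) renaming (zero to fzero; suc to fsuc)
open import Data.Fin.Properties using (toℕ<n)
open import Data.List using ([]; _∷_; _++_; drop)
open import Data.List.Properties using (length-++; length-++-≤ʳ)
open import Data.List.Relation.Unary.All using (All; []; _∷_; unzip)
open import Data.List.Relation.Unary.All.Properties using (++⁺)
open import Data.Vec using (Vec; lookup) renaming (_∷_ to _∷ᵥ_)
open import Data.Product using (_,_)
open import Data.Unit using (tt)
open import Relation.Binary.PropositionalEquality using (_≡_; refl; cong)
open import Relation.Nullary using (yes; no; contradiction)

-- A clause l₁ ∨ … ∨ lₖ becomes  t₁ ; #2 ; t₂ ; #2 ; … ; tₖ ; #2 ; !  where tᵢ tests lᵢ.
-- A test whose literal holds falls through to its #2, and the chain of #2s then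
-- hops over every later test and over the closing !, landing on the next clause;
-- if no literal holds, that ! ends the run with out still F.

varReg : ∀ {n} → Fin n → Reg
varReg v = inR (suc (toℕ v))

compileLiteral : ∀ {n} → Literal n → Instr
compileLiteral (lit v true)  = ptest (varReg v · get)
compileLiteral (lit v false) = ntest (varReg v · get)

compileClause : ∀ {n} → Clause n → InstrSeq
compileClause []      = halt ∷ []
compileClause (l ∷ c) = compileLiteral l ∷ jump 2 ∷ compileClause c

compileCNF : ∀ {n} → CNF n → InstrSeq
compileCNF []      = plain (outR · setT) ∷ halt ∷ []
compileCNF (c ∷ φ) = compileClause c ++ compileCNF φ

inputVal-varReg : ∀ {n} (bs : Vec Bool n) (v : Fin n) → inputVal bs (suc (toℕ v)) ≡ lookup bs v
inputVal-varReg (b ∷ᵥ bs) fzero    = refl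
inputVal-varReg (b ∷ᵥ bs) (fsuc v) = inputVal-varReg bs v

doBasic-varReg-get : ∀ {n} (bs : Vec Bool n) (v : Fin n) →
                     doBasic n (varReg v · get) (initState bs) ≡ reply (lookup bs v) (initState bs)
doBasic-varReg-get {n} bs v with 1 ≤? suc (toℕ v) | suc (toℕ v) ≤? n
... | yes _ | yes _ = cong (λ b → reply b (initState bs)) (inputVal-varReg bs v)
... | no 1≰ | _     = contradiction (s≤s z≤n) 1≰
... | yes _ | no v≰ = contradiction (toℕ<n v) v≰

module Execution {n : ℕ} (bs : Vec Bool n) where

  -- Fuel covering the length of X suffices, as every step moves forward.
  TerminatesWith : InstrSeq → Bool → Set
  TerminatesWith X b = ∀ k → length X ≤ k → exec n k X (initState bs) ≡ terminated b

  exec-compileLiteral : ∀ (l : Literal n) k rest →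
    exec n (suc k) (compileLiteral l ∷ rest) (initState bs)
      ≡ (if evalLit bs l then exec n k rest (initState bs) else exec n k (drop 1 rest) (initState bs))
  exec-compileLiteral (lit v true) k rest rewrite doBasic-varReg-get bs v with lookup bs v
  ... | true  = refl
  ... | false = refl
  exec-compileLiteral (lit v false) k rest rewrite doBasic-varReg-get bs v with lookup bs v
  ... | true  = refl
  ... | false = refl

  jump-over-clause : ∀ {Y b} (c : Clause n) → TerminatesWith Y b → TerminatesWith (jump 2 ∷ compileClause c ++ Y) b
  jump-over-clause []      Y↓ (suc k) (s≤s le) = Y↓ k (≤-trans (n≤1+n _) le)
  jump-over-clause (l ∷ c) Y↓ (suc k) (s≤s le) = jump-over-clause c Y↓ k (≤-trans (n≤1+n _) le)

  compileClause-correct : ∀ {Y b} (c : Clause n) → TerminatesWith Y b →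
                          TerminatesWith (compileClause c ++ Y) (evalClause bs c ∧ b)
  compileClause-correct [] Y↓ (suc k) le = refl
  compileClause-correct {Y} (l ∷ c) Y↓ (suc (suc k)) (s≤s (s≤s le))
    rewrite exec-compileLiteral l (suc k) (jump 2 ∷ compileClause c ++ Y) with evalLit bs l
  ... | true  = jump-over-clause c Y↓ (suc k) (s≤s le)
  ... | false = compileClause-correct c Y↓ (suc k) (≤-trans le (n≤1+n _))

  compileCNF-correct : ∀ (φ : CNF n) → TerminatesWith (compileCNF φ) (induced φ bs)
  compileCNF-correct []      (suc (suc k)) le = refl
  compileCNF-correct []      (suc 0)       (s≤s ())
  compileCNF-correct (c ∷ φ) = compileClause-correct c (compileCNF-correct φ)

open Execution using (compileCNF-correct)

AllowedInstr : Instr → Set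
AllowedInstr u = InstrOK Br0Basic u × NotOtherJump u

compileLiteral-allowed : ∀ {n} (l : Literal n) → AllowedInstr (compileLiteral l)
compileLiteral-allowed (lit v true)  = ptest (in-get _ (s≤s z≤n)) , tt
compileLiteral-allowed (lit v false) = ntest (in-get _ (s≤s z≤n)) , tt

compileClause-allowed : ∀ {n} (c : Clause n) → All AllowedInstr (compileClause c)
compileClause-allowed []      = (halt , tt) ∷ []
compileClause-allowed (l ∷ c) = compileLiteral-allowed l ∷ (jump 2 , refl) ∷ compileClause-allowed c

compileCNF-allowed : ∀ {n} (φ : CNF n) → All AllowedInstr (compileCNF φ)
compileCNF-allowed []      = (plain out-setT , tt) ∷ (halt , tt) ∷ []
compileCNF-allowed (c ∷ φ) = ++⁺ (compileClause-allowed c) (compileCNF-allowed φ)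

compileCNF-nonempty : ∀ {n} (φ : CNF n) → 1 ≤ length (compileCNF φ)
compileCNF-nonempty []      = s≤s z≤n
compileCNF-nonempty (c ∷ φ) = ≤-trans (compileCNF-nonempty φ) (length-++-≤ʳ (compileCNF φ) {compileClause c})

length-compileClause : ∀ {n} (c : Clause n) → length (compileClause c) ≤ 2 * suc (length c)
length-compileClause []      = s≤s z≤n
length-compileClause (l ∷ c) = begin
  2 + length (compileClause c) ≤⟨ +-monoʳ-≤ 2 (length-compileClause c) ⟩
  2 + 2 * suc (length c)       ≡⟨ *-suc 2 (suc (length c)) ⟨
  2 * suc (suc (length c))     ∎
  where open ≤-Reasoning

length-compileCNF : ∀ {n} (φ : CNF n) → length (compileCNF φ) ≤ 2 * size φ + 2
length-compileCNF []      = ≤-refl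
length-compileCNF (c ∷ φ) = begin
  length (compileClause c ++ compileCNF φ)           ≡⟨ length-++ (compileClause c) ⟩
  length (compileClause c) + length (compileCNF φ)   ≤⟨ +-mono-≤ (length-compileClause c) (length-compileCNF φ) ⟩
  2 * suc (length c) + (2 * size φ + 2)              ≡⟨ +-assoc (2 * suc (length c)) (2 * size φ) 2 ⟨
  2 * suc (length c) + 2 * size φ + 2                ≡⟨ cong (_+ 2) (*-distribˡ-+ 2 (suc (length c)) (size φ)) ⟨
  2 * (suc (length c) + size φ) + 2                  ∎
  where open ≤-Reasoning

proposition2 : Σ ℕ λ c → Σ ℕ λ d → ∀ (n : ℕ) (φ : CNF n) → Σ InstrSeq λ X → IS0-br X × OnlyJump2 X × Computes n X (induced φ) × length X ≤ c * size φ + d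
proposition2 = 2 , 2 , λ n φ →
  let (instrs-ok , jumps-ok) = unzip (compileCNF-allowed φ) in
  compileCNF φ ,
  (compileCNF-nonempty φ , instrs-ok) ,
  jumps-ok ,
  (λ bs → compileCNF-correct bs φ (length (compileCNF φ)) ≤-refl) ,
  length-compileCNF φ
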